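{- Let $(\rho_b,\rho_g,\iota)$ be an effect-oriented rule with maximal rule $\rho_g=(L_g\supseteq K_g\subseteq R_g,\mathit{ac}_g)$ and base rule $\rho_b=(L_b\supseteq K_b\subseteq R_b,\mathit{ac}_b)$, and let $\rho_i=(L_i\supseteq K_i\subseteq R_g,\mathit{ac}_i)$ be an induced rule of it, constructed from graphs $L_i'$ and $K_i$ as described in the context. Then $\rho_b$ is a subrule of $\rho_i$ via the embedding $(\iota_L^i,\iota_K^g,\iota_R)$, where $\iota_L^i\colon L_b\hookrightarrow L_i$ is the inclusion (composite of $L_b\subseteq L_i'$ and $u\colon L_i'\subseteq L_i$), $\iota_K^g\colon K_b=K_g\hookrightarrow K_i$ is the inclusion, and $\iota_R\colon R_b\hookrightarrow R_g$ is the inclusion.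
   Context: All graphs are finite directed multigraphs (sets of nodes and edges with source and target maps) typed over a fixed type graph, and all morphisms are type-preserving graph morphisms. A rule $\rho=(L\supseteq K\subseteq R,\mathit{ac})$ consists of graphs $L,K,R$ with $K$ a subgraph of both $L$ and $R$ (inclusions $l\colon K\hookrightarrow L$, $r\colon K\hookrightarrow R$) and a nested graph condition $\mathit{ac}$ over $L$ (application condition). For an injective morphism $f\colon L\hookrightarrow L'$, $\mathrm{Shift}(f,\mathit{ac})$ denotes the standard shift of $\mathit{ac}$ along $f$, a condition over $L'$ such that a morphism $m'\colon L'\to G$ satisfies it iff $m'\circ f$ satisfies $\mathit{ac}$. A rule $\rho'=(L'\supseteq K'\subseteq R',\mathit{ac}')$ is a subrule of $\rho=(L\supseteq K\subseteq R,\mathit{ac})$ via an embedding $(\iota_L,\iota_K,\iota_R)$ of injective morphisms $\iota_X\colon X'\hookrightarrow X$ if $\iota_L\circ l'=l\circ\iota_K$ and $\iota_R\circ r'=r\circ\iota_K$, both of these commuting squares are pullbacks, and $\mathit{ac}\equiv\mathrm{Shift}(\iota_L,\mathit{ac}')$. An effect-oriented rule $(\rho_b,\rho_g,\iota)$ consists of a rule $\rho_g=(L_g\supseteq K_g\subseteq R_g,\mathit{ac}_g)$ (maximal rule) and a subrule $\rho_b=(L_b\supseteq K_b\subseteq R_b,\mathit{ac}_b)$ (base rule) with subrule embedding $\iota=(\iota_L,\iota_K,\iota_R)$ consisting of inclusions, such that $K_b=K_g$ and $\iota_K$ is the identity. Induced rules: choose a graph $L_i'$ with $L_b\subseteq L_i'\subseteq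 L_g$ (inclusions $\iota_L^{i\prime}\colon L_b\hookrightarrow L_i'$, $\iota_L^{m\prime}\colon L_i'\hookrightarrow L_g$), and a graph $K_i$ with $K_g\subseteq K_i\subseteq R_g$ (inclusions $\iota_K^g\colon K_g\hookrightarrow K_i$, $r_i\colon K_i\hookrightarrow R_g$) such that the square $\iota_R\circ r_b=r_i\circ\iota_K^g$ is a pullback (i.e. $K_i\cap R_b=K_b$). Let $k_1\colon K_b\hookrightarrow L_i'$ be the inclusion and let $(L_i,u,l_i)$ be the pushout of $k_1$ and $\iota_K^g$, chosen so that $u\colon L_i'\hookrightarrow L_i$ and $l_i\colon K_i\hookrightarrow L_i$ are inclusions. Put $\iota_L^i=u\circ\iota_L^{i\prime}$ and $\mathit{ac}_i=\mathrm{Shift}(\iota_L^i,\mathit{ac}_b)$. The rule $\rho_i=(L_i\supseteq K_i\subseteq R_g,\mathit{ac}_i)$ obtained in this way is an induced rule of $(\rho_b,\rho_g,\iota)$. -}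

module Defs where

open import Data.Nat using (ℕ)
open import Data.Fin using (Fin)
open import Data.Product using (Σ; _×_; _,_)
open import Data.Unit using (⊤)
open import Relation.Nullary using (¬_)
open import Relation.Binary.PropositionalEquality using (_≡_)
open import Function.Bundles using (_⇔_)
open import Function.Definitions using (Injective)

record TypeGraph : Set where
  field
    nV nE : ℕ
    src tgt : Fin nE → Fin nV

record Graph (T : TypeGraph) : Set where
  field
    nV nE : ℕ
    src tgt : Fin nE → Fin nV
    tyV : Fin nV → Fin (TypeGraph.nV T)
    tyE : Fin nE → Fin (TypeGraph.nE T)
    tySrc : ∀ e → tyV (src e) ≡ TypeGraph.src T (tyE e)
    tyTgt : ∀ e → tyV (tgt e) ≡ TypeGraph.tgt T (tyE e)

module _ {T : TypeGraph} where

  open Graph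

  record Mor (G H : Graph T) : Set where
    field
      fV : Fin (nV G) → Fin (nV H)
      fE : Fin (nE G) → Fin (nE H)
      presSrc : ∀ e → fV (src G e) ≡ src H (fE e)
      presTgt : ∀ e → fV (tgt G e) ≡ tgt H (fE e)
      presTyV : ∀ v → tyV H (fV v) ≡ tyV G v
      presTyE : ∀ e → tyE H (fE e) ≡ tyE G e

  open Mor

  idM : {G : Graph T} → Mor G G
  idM = record
    { fV = λ v → v ; fE = λ e → e
    ; presSrc = λ e → _≡_.refl ; presTgt = λ e → _≡_.refl
    ; presTyV = λ v → _≡_.refl ; presTyE = λ e → _≡_.refl }

  infixr 9 _∘M_
  _∘M_ : {A B C : Graph T} → Mor B C → Mor A B → Mor A C
  _∘M_ {A} {B} {C} g f = record
    { fV = λ v → fV g (fV f v)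
    ; fE = λ e → fE g (fE f e)
    ; presSrc = λ e → trans (cong (fV g) (presSrc f e)) (presSrc g (fE f e))
    ; presTgt = λ e → trans (cong (fV g) (presTgt f e)) (presTgt g (fE f e))
    ; presTyV = λ v → trans (presTyV g (fV f v)) (presTyV f v)
    ; presTyE = λ e → trans (presTyE g (fE f e)) (presTyE f e) }
    where open Relation.Binary.PropositionalEquality using (trans; cong)

  infix 4 _≈M_
  _≈M_ : {A B : Graph T} → Mor A B → Mor A B → Set
  f ≈M g = (∀ v → fV f v ≡ fV g v) × (∀ e → fE f e ≡ fE g e)

  -- Injective morphisms (inclusions up to isomorphism).
  InjectiveM : {A B : Graph T} → Mor A B → Set
  InjectiveM f = Injective _≡_ _≡_ (fV f) × Injective _≡_ _≡_ (fE f)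

  record IsPullback {A B C D : Graph T}
                    (f : Mor A B) (g : Mor A C) (h : Mor B D) (k : Mor C D) : Set₁ where
    field
      commutes : h ∘M f ≈M k ∘M g
      universal : ∀ {X : Graph T} (p : Mor X B) (q : Mor X C) → h ∘M p ≈M k ∘M q →
                  Σ (Mor X A) λ x → (f ∘M x ≈M p) × (g ∘M x ≈M q) ×
                    (∀ (y : Mor X A) → f ∘M y ≈M p → g ∘M y ≈M q → y ≈M x)

  record IsPushout {A B C D : Graph T}
                   (f : Mor A B) (g : Mor A C) (h : Mor B D) (k : Mor C D) : Set₁ where
    field
      commutes : h ∘M f ≈M k ∘M g
      universal : ∀ {X : Graph T} (p : Mor B X) (q : Mor C X) → p ∘M f ≈M q ∘M g →
                  Σ (Mor D X) λ x → (x ∘M h ≈M p) × (x ∘M k ≈M q) ×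
                    (∀ (y : Mor D X) → y ∘M h ≈M p → y ∘M k ≈M q → y ≈M x)

  data Cond (P : Graph T) : Set where
    true : Cond P
    not  : Cond P → Cond P
    and  : (n : ℕ) → (Fin n → Cond P) → Cond P
    exists : (C : Graph T) → Mor P C → Cond C → Cond P

  infix 4 _⊨_
  _⊨_ : {P G : Graph T} → Mor P G → Cond P → Set
  m ⊨ true = ⊤
  m ⊨ not c = ¬ (m ⊨ c)
  m ⊨ and n cs = ∀ i → m ⊨ cs i
  _⊨_ {G = G} m (exists C a c) =
    Σ (Mor C G) λ q → InjectiveM q × (q ∘M a ≈M m) × (q ⊨ c)

  infix 4 _≡C_
  _≡C_ : {P : Graph T} → Cond P → Cond P → Set
  _≡C_ {P} c c' = ∀ (G : Graph T) (m : Mor P G) → (m ⊨ c) ⇔ (m ⊨ c')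

  -- The shift of conditions along injective morphisms, given by its
  -- defining property.
  record ShiftOp : Set₁ where
    field
      Shift : {P P' : Graph T} → Mor P P' → Cond P → Cond P'
      spec  : {P P' : Graph T} (f : Mor P P') → InjectiveM f → (ac : Cond P) →
              ∀ {G : Graph T} (m' : Mor P' G) → (m' ⊨ Shift f ac) ⇔ (m' ∘M f ⊨ ac)

  record Rule : Set where
    constructor mkRule
    field
      L K R : Graph T
      l : Mor K L
      r : Mor K R
      l-inj : InjectiveM l
      r-inj : InjectiveM r
      ac : Cond L

  record Subrule (S : ShiftOp) (ρ' ρ : Rule)
                 (ιL : Mor (Rule.L ρ') (Rule.L ρ))
                 (ιK : Mor (Rule.K ρ') (Rule.K ρ))
                 (ιR : Mor (Rule.R ρ') (Rule.R ρ)) : Set₁ where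
    field
      ιL-inj : InjectiveM ιL
      ιK-inj : InjectiveM ιK
      ιR-inj : InjectiveM ιR
      pbL : IsPullback (Rule.l ρ') ιK ιL (Rule.l ρ)
      pbR : IsPullback (Rule.r ρ') ιK ιR (Rule.r ρ)
      acEq : Rule.ac ρ ≡C ShiftOp.Shift S ιL (Rule.ac ρ')

  record EORule (S : ShiftOp) : Set₁ where
    field
      K Lb Rb Lg Rg : Graph T
      lb : Mor K Lb
      rb : Mor K Rb
      lg : Mor K Lg
      rg : Mor K Rg
      lb-inj : InjectiveM lb
      rb-inj : InjectiveM rb
      lg-inj : InjectiveM lg
      rg-inj : InjectiveM rg
      acb : Cond Lb
      acg : Cond Lg
      ιL : Mor Lb Lg
      ιR : Mor Rb Rg

    baseRule : Rule
    baseRule = mkRule Lb K Rb lb rb lb-inj rb-inj acb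

    maxRule : Rule
    maxRule = mkRule Lg K Rg lg rg lg-inj rg-inj acg

    field
      isSubrule : Subrule S baseRule maxRule ιL idM ιR

  record Induced {S : ShiftOp} (E : EORule S) : Set₁ where
    open EORule E
    field
      Li' : Graph T
      ιLi' : Mor Lb Li'
      ιLm' : Mor Li' Lg
      ιLi'-inj : InjectiveM ιLi'
      ιLm'-inj : InjectiveM ιLm'
      triL : ιLm' ∘M ιLi' ≈M ιL
      Ki : Graph T
      ιKg : Mor K Ki
      ri : Mor Ki Rg
      ιKg-inj : InjectiveM ιKg
      ri-inj : InjectiveM ri
      triK : ri ∘M ιKg ≈M rg
      pbRi : IsPullback rb ιKg ιR ri

    k1 : Mor K Li'
    k1 = ιLi' ∘M lb

    field
      Li : Graph T
      u : Mor Li' Li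
      li : Mor Ki Li
      u-inj : InjectiveM u
      li-inj : InjectiveM li
      po : IsPushout k1 ιKg u li

    ιLi : Mor Lb Li
    ιLi = u ∘M ιLi'

    aci : Cond Li
    aci = ShiftOp.Shift S ιLi acb

    inducedRule : Rule
    inducedRule = mkRule Li Ki Rg li ri li-inj ri-inj aci

-- Only the pullback property of the left square K → Lb, Ki → Li needs an argument;
-- the right square is a hypothesis of the induced rule, and the application condition
-- of the induced rule is the shift of acb along ιLi by construction. The pushout of
-- Li' ← K → Ki is taken along the injective K ↪ Ki, and in graphs a pushout along an
-- injective morphism is also a pullback: comparing it with the concrete gluing of Li'
-- and Ki over K shows that Li' and Ki meet in Li only over K. Factoring the injective
-- Lb ↪ Li' out of the top side of a pullback leaves a pullback, which is the left square.

module Submission where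

open import Data.Nat using (ℕ; _+_)
open import Data.Fin using (Fin; _↑ˡ_; _↑ʳ_; splitAt; _≟_)
open import Data.Fin.Properties using (↑ˡ-injective; splitAt-↑ˡ; splitAt-↑ʳ; any?)
open import Data.Product using (Σ; ∃; _×_; _,_; proj₁; proj₂)
open import Data.Sum using (_⊎_; inj₁; inj₂; [_,_]′)
open import Data.Empty using (⊥-elim)
open import Function.Base using (_∘_; id)
open import Function.Bundles using (mk⇔)
open import Function.Definitions using (Injective)
open import Relation.Nullary using (Dec; yes; no; ¬_)
open import Relation.Binary.PropositionalEquality

open import Defs

module _ {T : TypeGraph} where

  open Graph
  open Mor

  ∘M-injective : {A B C : Graph T} (g : Mor B C) (f : Mor A B) →
                 InjectiveM g → InjectiveM f → InjectiveM (g ∘M f)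
  ∘M-injective _ _ (g-injV , g-injE) (f-injV , f-injE) = f-injV ∘ g-injV , f-injE ∘ g-injE

  factor-through-injective :
    {X K B : Graph T} (g : Mor K B) → InjectiveM g → (q : Mor X B) →
    (∀ v → ∃ λ k → fV g k ≡ fV q v) → (∀ e → ∃ λ k → fE g k ≡ fE q e) →
    Σ (Mor X K) λ x → g ∘M x ≈M q
  factor-through-injective {X} {K} {B} g (g-injV , _) q preV preE =
    record
      { fV = xV ; fE = xE
      ; presSrc = λ e → g-injV (begin
          fV g (xV (src X e))  ≡⟨ gxV (src X e) ⟩
          fV q (src X e)       ≡⟨ presSrc q e ⟩
          src B (fE q e)       ≡⟨ cong (src B) (gxE e) ⟨
          src B (fE g (xE e))  ≡⟨ presSrc g (xE e) ⟨
          fV g (src K (xE e))  ∎)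
      ; presTgt = λ e → g-injV (begin
          fV g (xV (tgt X e))  ≡⟨ gxV (tgt X e) ⟩
          fV q (tgt X e)       ≡⟨ presTgt q e ⟩
          tgt B (fE q e)       ≡⟨ cong (tgt B) (gxE e) ⟨
          tgt B (fE g (xE e))  ≡⟨ presTgt g (xE e) ⟨
          fV g (tgt K (xE e))  ∎)
      ; presTyV = λ v → trans (sym (presTyV g (xV v))) (trans (cong (tyV B) (gxV v)) (presTyV q v))
      ; presTyE = λ e → trans (sym (presTyE g (xE e))) (trans (cong (tyE B) (gxE e)) (presTyE q e))
      }
    , gxV , gxE
    where
    open ≡-Reasoning
    xV = proj₁ ∘ preV
    xE = proj₁ ∘ preE
    gxV : ∀ v → fV g (xV v) ≡ fV q v
    gxV = proj₂ ∘ preV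
    gxE : ∀ e → fE g (xE e) ≡ fE q e
    gxE = proj₂ ∘ preE

  IsPullback-factor-injective :
    {K A A' B D : Graph T} {f : Mor K A} {m : Mor A A'} {g : Mor K B}
    {h : Mor A' D} {l : Mor B D} →
    InjectiveM m → IsPullback (m ∘M f) g h l → IsPullback f g (h ∘M m) l
  IsPullback-factor-injective {m = m} (m-injV , m-injE) pb = record
    { commutes = commutes
    ; universal = λ p q hmp≈lq →
        let x , (mfx≈mpV , mfx≈mpE) , gx≈q , unique = universal (m ∘M p) q hmp≈lq
        in x , (m-injV ∘ mfx≈mpV , m-injE ∘ mfx≈mpE) , gx≈q ,
           λ y (fy≈pV , fy≈pE) → unique y (cong (fV m) ∘ fy≈pV , cong (fE m) ∘ fy≈pE)
    }
    where open IsPullback pb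

module FinGluing {k a b : ℕ} (f : Fin k → Fin a) (g : Fin k → Fin b) where

  private
    glueWith : ∀ y → Dec (∃ λ x → g x ≡ y) → Fin (a + b)
    glueWith y (yes (x , _)) = f x ↑ˡ b
    glueWith y (no _)        = a ↑ʳ y

  glue : Fin b → Fin (a + b)
  glue y = glueWith y (any? λ x → g x ≟ y)

  glue-elim : (P : Fin b → Fin (a + b) → Set) →
              (∀ x → P (g x) (f x ↑ˡ b)) →
              (∀ y → ¬ (∃ λ x → g x ≡ y) → P y (a ↑ʳ y)) →
              ∀ y → P y (glue y)
  glue-elim P glued fresh y with any? (λ x → g x ≟ y)
  ... | yes (x , refl) = glued x
  ... | no ∄x          = fresh y ∄x

  glue-∘ : Injective _≡_ _≡_ g → ∀ x → glue (g x) ≡ f x ↑ˡ b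
  glue-∘ g-inj x = glue-elim (λ y z → g x ≡ y → z ≡ f x ↑ˡ b)
    (λ x' gx≡gx' → cong (λ w → f w ↑ˡ b) (g-inj (sym gx≡gx')))
    (λ y ∄x gx≡y → ⊥-elim (∄x (x , gx≡y)))
    (g x) refl

  glue-label : {C : Set} (cA : Fin a → C) (cB : Fin b → C) → (∀ x → cA (f x) ≡ cB (g x)) →
               ∀ y → [ cA , cB ]′ (splitAt a (glue y)) ≡ cB y
  glue-label cA cB compatible = glue-elim (λ y z → [ cA , cB ]′ (splitAt a z) ≡ cB y)
    (λ x → trans (cong [ cA , cB ]′ (splitAt-↑ˡ a (f x) b)) (compatible x))
    (λ y _ → cong [ cA , cB ]′ (splitAt-↑ʳ a b y))

  ↑ˡ≡glue⇒preimage : ∀ {i y} → i ↑ˡ b ≡ glue y → ∃ λ x → g x ≡ y × f x ≡ i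
  ↑ˡ≡glue⇒preimage {i} = glue-elim (λ y z → i ↑ˡ b ≡ z → ∃ λ x → g x ≡ y × f x ≡ i)
    (λ x i≡fx → x , refl , sym (↑ˡ-injective b i (f x) i≡fx))
    (λ y _ i≡y → ⊥-elim (↑ˡ≢↑ʳ i≡y))
    _
    where
    ↑ˡ≢↑ʳ : ∀ {y} → i ↑ˡ b ≢ a ↑ʳ y
    ↑ˡ≢↑ʳ {y} eq with trans (sym (splitAt-↑ˡ a i b)) (trans (cong (splitAt a) eq) (splitAt-↑ʳ a b y))
    ... | ()

module Gluing {T : TypeGraph} {K A B : Graph T} (f : Mor K A) (g : Mor K B)
              (g-inj : InjectiveM g) where

  open Graph
  open Mor
  open ≡-Reasoning

  module V = FinGluing (fV f) (fV g)
  module E = FinGluing (fE f) (fE g)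

  private
    tyVG : Fin (nV A + nV B) → Fin (TypeGraph.nV T)
    tyVG = [ tyV A , tyV B ]′ ∘ splitAt (nV A)

    tyEG : Fin (nE A + nE B) → Fin (TypeGraph.nE T)
    tyEG = [ tyE A , tyE B ]′ ∘ splitAt (nE A)

    tyVG-↑ˡ : ∀ v → tyVG (v ↑ˡ nV B) ≡ tyV A v
    tyVG-↑ˡ v = cong [ tyV A , tyV B ]′ (splitAt-↑ˡ (nV A) v (nV B))

    tyEG-↑ˡ : ∀ e → tyEG (e ↑ˡ nE B) ≡ tyE A e
    tyEG-↑ˡ e = cong [ tyE A , tyE B ]′ (splitAt-↑ˡ (nE A) e (nE B))

    tyVG-glue : ∀ v → tyVG (V.glue v) ≡ tyV B v
    tyVG-glue = V.glue-label (tyV A) (tyV B) λ x → trans (presTyV f x) (sym (presTyV g x))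

    tyEG-glue : ∀ e → tyEG (E.glue e) ≡ tyE B e
    tyEG-glue = E.glue-label (tyE A) (tyE B) λ x → trans (presTyE f x) (sym (presTyE g x))

    module Endpoint (s : (G : Graph T) → Fin (nE G) → Fin (nV G))
                    (sT : Fin (TypeGraph.nE T) → Fin (TypeGraph.nV T))
                    (s-typed : (G : Graph T) → ∀ e → tyV G (s G e) ≡ sT (tyE G e))
                    (f-pres : ∀ e → fV f (s K e) ≡ s A (fE f e))
                    (g-pres : ∀ e → fV g (s K e) ≡ s B (fE g e)) where

      sG⊎ : Fin (nE A) ⊎ Fin (nE B) → Fin (nV A + nV B)
      sG⊎ = [ (λ e → s A e ↑ˡ nV B) , V.glue ∘ s B ]′

      sG : Fin (nE A + nE B) → Fin (nV A + nV B)
      sG = sG⊎ ∘ splitAt (nE A)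

      sG⊎-typed : ∀ e → tyVG (sG⊎ e) ≡ sT ([ tyE A , tyE B ]′ e)
      sG⊎-typed (inj₁ e) = trans (tyVG-↑ˡ (s A e)) (s-typed A e)
      sG⊎-typed (inj₂ e) = trans (tyVG-glue (s B e)) (s-typed B e)

      sG-typed : ∀ e → tyVG (sG e) ≡ sT (tyEG e)
      sG-typed = sG⊎-typed ∘ splitAt (nE A)

      sG-↑ˡ : ∀ e → s A e ↑ˡ nV B ≡ sG (e ↑ˡ nE B)
      sG-↑ˡ e = cong sG⊎ (sym (splitAt-↑ˡ (nE A) e (nE B)))

      sG-glue : ∀ e → V.glue (s B e) ≡ sG (E.glue e)
      sG-glue = E.glue-elim (λ e z → V.glue (s B e) ≡ sG z)
        (λ x → begin
          V.glue (s B (fE g x))    ≡⟨ cong V.glue (g-pres x) ⟨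
          V.glue (fV g (s K x))    ≡⟨ V.glue-∘ (proj₁ g-inj) (s K x) ⟩
          fV f (s K x) ↑ˡ nV B     ≡⟨ cong (_↑ˡ nV B) (f-pres x) ⟩
          s A (fE f x) ↑ˡ nV B     ≡⟨ sG-↑ˡ (fE f x) ⟩
          sG (fE f x ↑ˡ nE B)      ∎)
        (λ e _ → cong sG⊎ (sym (splitAt-↑ʳ (nE A) (nE B) e)))

    module Src = Endpoint src (TypeGraph.src T) tySrc (presSrc f) (presSrc g)
    module Tgt = Endpoint tgt (TypeGraph.tgt T) tyTgt (presTgt f) (presTgt g)

  -- Not quite the pushout: the nodes and edges of B in the image of g keep unused copies,
  -- which is harmless since only the separation of A from B outside K is needed.
  glued : Graph T
  glued = record
    { nV = nV A + nV B ; nE = nE A + nE B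
    ; src = Src.sG ; tgt = Tgt.sG
    ; tyV = tyVG ; tyE = tyEG
    ; tySrc = Src.sG-typed ; tyTgt = Tgt.sG-typed
    }

  inl : Mor A glued
  inl = record
    { fV = _↑ˡ nV B ; fE = _↑ˡ nE B
    ; presSrc = Src.sG-↑ˡ ; presTgt = Tgt.sG-↑ˡ
    ; presTyV = tyVG-↑ˡ ; presTyE = tyEG-↑ˡ
    }

  inr : Mor B glued
  inr = record
    { fV = V.glue ; fE = E.glue
    ; presSrc = Src.sG-glue ; presTgt = Tgt.sG-glue
    ; presTyV = tyVG-glue ; presTyE = tyEG-glue
    }

  inl∘f≈inr∘g : inl ∘M f ≈M inr ∘M g
  inl∘f≈inr∘g = sym ∘ V.glue-∘ (proj₁ g-inj) , sym ∘ E.glue-∘ (proj₂ g-inj)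

module _ {T : TypeGraph} where

  open Graph
  open Mor

  MeetOnlyOver : {K A B D : Graph T} →
                 Mor K A → Mor K B → Mor A D → Mor B D → Set
  MeetOnlyOver f g h l =
    (∀ {a b} → fV h a ≡ fV l b → ∃ λ k → fV g k ≡ b × fV f k ≡ a) ×
    (∀ {a b} → fE h a ≡ fE l b → ∃ λ k → fE g k ≡ b × fE f k ≡ a)

  IsPushout-injective⇒MeetOnlyOver :
    {K A B D : Graph T} {f : Mor K A} {g : Mor K B} {h : Mor A D} {l : Mor B D} →
    InjectiveM g → IsPushout f g h l → MeetOnlyOver f g h l
  IsPushout-injective⇒MeetOnlyOver {f = f} {g} {h} {l} g-inj po =
    (λ {a} {b} ha≡lb → V.↑ˡ≡glue⇒preimage (begin
      fV inl a          ≡⟨ proj₁ c∘h≈inl a ⟨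
      fV c (fV h a)     ≡⟨ cong (fV c) ha≡lb ⟩
      fV c (fV l b)     ≡⟨ proj₁ c∘l≈inr b ⟩
      fV inr b          ∎)) ,
    (λ {a} {b} ha≡lb → E.↑ˡ≡glue⇒preimage (begin
      fE inl a          ≡⟨ proj₂ c∘h≈inl a ⟨
      fE c (fE h a)     ≡⟨ cong (fE c) ha≡lb ⟩
      fE c (fE l b)     ≡⟨ proj₂ c∘l≈inr b ⟩
      fE inr b          ∎))
    where
    open Gluing f g g-inj
    open ≡-Reasoning
    comparison = IsPushout.universal po inl inr inl∘f≈inr∘g
    c = proj₁ comparison
    c∘h≈inl = proj₁ (proj₂ comparison)
    c∘l≈inr = proj₁ (proj₂ (proj₂ comparison))

  MeetOnlyOver⇒IsPullback :
    {K A B D : Graph T} {f : Mor K A} {g : Mor K B} {h : Mor A D} {l : Mor B D} →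
    InjectiveM g → h ∘M f ≈M l ∘M g → MeetOnlyOver f g h l → IsPullback f g h l
  MeetOnlyOver⇒IsPullback {K} {A} {B} {f = f} {g} {h} {l}
                          g-inj@(g-injV , g-injE) commutes (meetV , meetE) = record
    { commutes = commutes
    ; universal = universal
    }
    where
    universal : ∀ {X : Graph T} (p : Mor X A) (q : Mor X B) → h ∘M p ≈M l ∘M q →
                Σ (Mor X K) λ x → (f ∘M x ≈M p) × (g ∘M x ≈M q) ×
                  (∀ (y : Mor X K) → f ∘M y ≈M p → g ∘M y ≈M q → y ≈M x)
    universal {X} p q (hp≈lqV , hp≈lqE) = x , (fx≈pV , fx≈pE) , (gx≈qV , gx≈qE) , unique
      where
      preV = meetV ∘ hp≈lqV
      preE = meetE ∘ hp≈lqE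
      factorisation = factor-through-injective g g-inj q
        (λ v → proj₁ (preV v) , proj₁ (proj₂ (preV v)))
        (λ e → proj₁ (preE e) , proj₁ (proj₂ (preE e)))
      x = proj₁ factorisation
      gx≈qV = proj₁ (proj₂ factorisation)
      gx≈qE = proj₂ (proj₂ factorisation)
      fx≈pV : ∀ v → fV f (fV x v) ≡ fV p v
      fx≈pV v = let _ , gk≡qv , fk≡pv = preV v in
        trans (cong (fV f) (g-injV (trans (gx≈qV v) (sym gk≡qv)))) fk≡pv
      fx≈pE : ∀ e → fE f (fE x e) ≡ fE p e
      fx≈pE e = let _ , gk≡qe , fk≡pe = preE e in
        trans (cong (fE f) (g-injE (trans (gx≈qE e) (sym gk≡qe)))) fk≡pe
      unique : ∀ (y : Mor X K) → f ∘M y ≈M p → g ∘M y ≈M q → y ≈M x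
      unique y _ (gy≈qV , gy≈qE) =
        (λ v → g-injV (trans (gy≈qV v) (sym (gx≈qV v)))) ,
        (λ e → g-injE (trans (gy≈qE e) (sym (gx≈qE e))))

  IsPushout-injective⇒IsPullback :
    {K A B D : Graph T} {f : Mor K A} {g : Mor K B} {h : Mor A D} {l : Mor B D} →
    InjectiveM g → IsPushout f g h l → IsPullback f g h l
  IsPushout-injective⇒IsPullback g-inj po =
    MeetOnlyOver⇒IsPullback g-inj (IsPushout.commutes po) (IsPushout-injective⇒MeetOnlyOver g-inj po)

proposition1 : (T : TypeGraph) (S : ShiftOp {T}) (E : EORule S) (I : Induced E) →
               Subrule S (EORule.baseRule E) (Induced.inducedRule I)
                 (Induced.ιLi I) (Induced.ιKg I) (EORule.ιR E)
proposition1 T S E I = record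
  { ιL-inj = ∘M-injective u ιLi' u-inj ιLi'-inj
  ; ιK-inj = ιKg-inj
  ; ιR-inj = Subrule.ιR-inj isSubrule
  ; pbL = IsPullback-factor-injective ιLi'-inj (IsPushout-injective⇒IsPullback ιKg-inj po)
  ; pbR = pbRi
  ; acEq = λ _ _ → mk⇔ id id
  }
  where
  open EORule E
  open Induced I
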